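{- Let $t$ be a term with $\mathrm{normal}_{\mathrm{cbv}}(t)$. Then there exists a tight derivation in the CbV type system of $\vdash^{(0,0)} t:\mathbf 0$.
   Context: Terms: $t,s ::= x \mid \lambda x.t \mid t\,s \mid t[x\leftarrow s]$, where $t[x\leftarrow s]$ (explicit substitution) binds $x$ in $t$. $\mathrm{normal}_{\mathrm{cbv}}$: least predicate with $\mathrm{normal}_{\mathrm{cbv}}(\lambda x.t)$ and ($\mathrm{normal}_{\mathrm{cbv}}(t)$ and $\mathrm{normal}_{\mathrm{cbv}}(s)$) $\Rightarrow\mathrm{normal}_{\mathrm{cbv}}(t[x\leftarrow s])$. CbV types: linear types $L ::= M\to N$; multi types $M,N ::= [L_i]_{i\in J}$ finite multisets, $\mathbf 0$ empty multiset, $\uplus$ union. Type contexts $\Gamma$ map variables to multi types, all but finitely many to $\mathbf 0$; $\mathrm{dom}(\Gamma)=\{x\mid\Gamma(x)\ne\mathbf 0\}$; $\Gamma$ empty if its domain is empty; $\uplus$ pointwise; $\Gamma,x:M$ means $\Gamma\uplus(x\mapsto M)$ with $x\notin\mathrm{dom}(\Gamma)$. Rules: (ax) $x:M\vdash^{(0,1)} x:M$ for any multi type $M$; (app) from $\Gamma\vdash^{(m,e)} t:[M\to N]$ and $\Pi\vdash^{(m',e')} s:M$ infer $\Gamma\uplus\Pi\vdash^{(m+m'+1,e+e')} t\,s:N$; (fun) from $\Gamma,x:N\vdash^{(m,e)} t:M$ infer $\Gamma\vdash^{(m,e)}\lambda x.t:N\to M$; (many) from $\Pi_i\vdash^{(m_i,e_i)}\lambda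 x.t:L_i$ for $i\in J$ ($J$ finite, possibly empty) infer $\biguplus_i\Pi_i\vdash^{(\sum m_i,\sum e_i)}\lambda x.t:[L_i]_{i\in J}$; (ES) from $\Gamma,x:N\vdash^{(m,e)} t:M$ and $\Pi\vdash^{(m',e')} s:N$ infer $\Gamma\uplus\Pi\vdash^{(m+m',e+e')} t[x\leftarrow s]:M$. A derivation of $\Gamma\vdash^{(m,e)} t:M$ is tight if $M=\mathbf 0$ and $\Gamma$ is empty. -}

module Defs where

open import Data.Nat using (ℕ; zero; suc; _+_; _≟_)
open import Data.List using (List; []; _∷_; _++_)
open import Relation.Nullary using (yes; no)
open import Relation.Binary.PropositionalEquality using (_≡_)

Var : Set
Var = ℕ

data Term : Set where
  var  : Var → Term
  lam  : Var → Term → Term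
  app  : Term → Term → Term
  esub : Term → Var → Term → Term   -- esub t x s  =  t[x←s]  (binds x in t)

data normal-cbv : Term → Set where
  n-lam  : ∀ {x t} → normal-cbv (lam x t)
  n-esub : ∀ {t x s} → normal-cbv t → normal-cbv s → normal-cbv (esub t x s)

-- CbV types: linear types L ::= M → N ; multi types = finite multisets of
-- linear types, represented as lists (𝟎 = [], ⊎ = ++).
mutual
  data LType : Set where
    _⇒_ : MType → MType → LType

  MType : Set
  MType = List LType

𝟎 : MType
𝟎 = []

Ctx : Set
Ctx = Var → MType

_≈ᶜ_ : Ctx → Ctx → Set
Γ ≈ᶜ Δ = ∀ y → Γ y ≡ Δ y

emptyᶜ : Ctx
emptyᶜ _ = 𝟎

IsEmpty : Ctx → Set
IsEmpty Γ = ∀ y → Γ y ≡ 𝟎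

_⊎ᶜ_ : Ctx → Ctx → Ctx
(Γ ⊎ᶜ Δ) y = Γ y ++ Δ y

_↦_ : Var → MType → Ctx
(x ↦ M) y with x ≟ y
... | yes _ = M
... | no  _ = 𝟎

-- Typing judgements  Γ ⊢^(m,e) t : M   (Der Γ t M m e)
-- and the auxiliary  Γ ⊢^(m,e) λx.t : L  (DerL), plus the (many) premises
-- family (Many) for a finite index set J, listed in order.
mutual
  data Der : Ctx → Term → MType → ℕ → ℕ → Set where
    ax   : ∀ {Γ x M} → Γ ≈ᶜ (x ↦ M) → Der Γ (var x) M 0 1
    app  : ∀ {Δ Γ Π t s M N m e m' e'} →
           Δ ≈ᶜ (Γ ⊎ᶜ Π) →
           Der Γ t ((M ⇒ N) ∷ []) m e → Der Π s M m' e' →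
           Der Δ (app t s) N (m + m' + 1) (e + e')
    many : ∀ {Γ x t Ls m e} → Many Γ x t Ls m e → Der Γ (lam x t) Ls m e
    es   : ∀ {Δ Γ Π t x s M N m e m' e'} →
           Γ x ≡ 𝟎 →
           Δ ≈ᶜ ((Γ ⊎ᶜ (x ↦ N)) ⊎ᶜ Π) →
           Der (Γ ⊎ᶜ (x ↦ N)) t M m e → Der Π s N m' e' →
           Der Δ (esub t x s) M (m + m') (e + e')

  data DerL : Ctx → Term → LType → ℕ → ℕ → Set where
    fun : ∀ {Γ x t M N m e} →
          Γ x ≡ 𝟎 →
          Der (Γ ⊎ᶜ (x ↦ N)) t M m e →
          DerL Γ (lam x t) (N ⇒ M) m e

  data Many : Ctx → Var → Term → MType → ℕ → ℕ → Set where
    []ᵐ  : ∀ {Γ x t} → IsEmpty Γ → Many Γ x t [] 0 0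
    consᵐ : ∀ {Δ Π Γ x t L Ls m e m' e'} →
           Δ ≈ᶜ (Π ⊎ᶜ Γ) →
           DerL Π (lam x t) L m e → Many Γ x t Ls m' e' →
           Many Δ x t (L ∷ Ls) (m + m') (e + e')

record Tight {Γ t M m e} (d : Der Γ t M m e) : Set where
  field
    type-empty : M ≡ 𝟎
    ctx-empty  : IsEmpty Γ

{-# OPTIONS --safe #-}
module Submission where

-- A CbV normal form is an abstraction under a stack of explicit substitutions.
-- An abstraction gets type 𝟎 by (many) with no premises, and t[x←s] gets 𝟎 by
-- giving both x and s the type 𝟎; no (ax) or (app) is ever used, so both
-- counters stay 0.

open import Defs
open import Data.Product using (Σ-syntax; _,_)
open import Data.Nat using (_≟_)
open import Data.List using (_++_)
open import Relation.Nullary using (yes; no)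
open import Relation.Binary.PropositionalEquality using (refl; sym; trans; cong₂)

emptyᶜ-isEmpty : IsEmpty emptyᶜ
emptyᶜ-isEmpty _ = refl

↦𝟎-isEmpty : ∀ x → IsEmpty (x ↦ 𝟎)
↦𝟎-isEmpty x y with x ≟ y
... | yes _ = refl
... | no  _ = refl

⊎ᶜ-isEmpty : ∀ {Γ Δ} → IsEmpty Γ → IsEmpty Δ → IsEmpty (Γ ⊎ᶜ Δ)
⊎ᶜ-isEmpty Γ-empty Δ-empty y = cong₂ _++_ (Γ-empty y) (Δ-empty y)

isEmpty-≈ᶜ : ∀ {Γ Δ} → IsEmpty Γ → IsEmpty Δ → Γ ≈ᶜ Δ
isEmpty-≈ᶜ Γ-empty Δ-empty y = trans (Γ-empty y) (sym (Δ-empty y))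

normal⇒Der𝟎 : ∀ {Γ t} → IsEmpty Γ → normal-cbv t → Der Γ t 𝟎 0 0
normal⇒Der𝟎 Γ-empty n-lam = many ([]ᵐ Γ-empty)
normal⇒Der𝟎 {Γ} Γ-empty (n-esub {x = x} t-normal s-normal) =
  es {Π = emptyᶜ} {N = 𝟎} (Γ-empty x)
     (isEmpty-≈ᶜ Γ-empty (⊎ᶜ-isEmpty Γ,x:𝟎-empty emptyᶜ-isEmpty))
     (normal⇒Der𝟎 Γ,x:𝟎-empty t-normal)
     (normal⇒Der𝟎 emptyᶜ-isEmpty s-normal)
  where
  Γ,x:𝟎-empty : IsEmpty (Γ ⊎ᶜ (x ↦ 𝟎))
  Γ,x:𝟎-empty = ⊎ᶜ-isEmpty Γ-empty (↦𝟎-isEmpty x)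

proposition8 : (t : Term) → normal-cbv t →
                 Σ[ d ∈ Der emptyᶜ t 𝟎 0 0 ] Tight d
proposition8 t t-normal =
  normal⇒Der𝟎 emptyᶜ-isEmpty t-normal ,
  record { type-empty = refl ; ctx-empty = emptyᶜ-isEmpty }
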